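{- Let $T$ be a perfect Roman domination stable tree and $u\in W(T)$. If $T'$ is the tree obtained from $T$ by adding a new path $v_2v_1$ (on two new vertices) and the edge $uv_2$, then $\gamma_R^p(T')=\gamma_R^p(T)+2$.
   Context: All graphs are finite and simple. A perfect Roman dominating function (PRDF) on a graph $G=(V,E)$ is a function $f:V\to\{0,1,2\}$ such that every vertex $u$ with $f(u)=0$ is adjacent to exactly one vertex $v$ with $f(v)=2$. Its weight is $w(f)=\sum_{u\in V}f(u)$, and $\gamma_R^p(G)$ is the minimum weight of a PRDF on $G$; a PRDF of weight $\gamma_R^p(G)$ is a $\gamma_R^p$-function of $G$. A graph $G$ is perfect Roman domination stable if $\gamma_R^p(G-v)=\gamma_R^p(G)$ for every vertex $v\in V(G)$. For a tree $T$, $W(T)=\{u\in V(T): f(u)=0 \text{ for every } \gamma_R^p\text{ -function } f \text{ of } T\}$. -}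

module Defs where

open import Data.Nat using (ℕ; zero; suc; _+_; _≤_)
open import Data.Fin using (Fin; zero; suc; punchIn)
open import Data.Bool using (Bool; true; false)
open import Data.List using (List; []; _∷_; _∷ʳ_; length; map; allFin)
open import Data.Nat.ListAction using (sum)
open import Data.List.Relation.Unary.Unique.Propositional using (Unique)
open import Data.Product using (Σ; _×_; ∃)
open import Relation.Binary.PropositionalEquality using (_≡_)
open import Relation.Nullary using (¬_)
open import Relation.Nullary.Decidable using (isYes)
open import Data.Fin using (_≟_)
open import Relation.Binary.PropositionalEquality using (refl)

record Graph (n : ℕ) : Set where
  field
    adj    : Fin n → Fin n → Bool
    sym    : ∀ u v → adj u v ≡ adj v u
    irrefl : ∀ u → adj u u ≡ false
open Graph public

Edge : ∀ {n} → Graph n → Fin n → Fin n → Set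
Edge G u v = adj G u v ≡ true

data Walk {n} (G : Graph n) : Fin n → Fin n → Set where
  here : ∀ {u} → Walk G u u
  step : ∀ {u v w} → Edge G u v → Walk G v w → Walk G u w

Connected : ∀ {n} → Graph n → Set
Connected G = ∀ u v → Walk G u v

data Chain {n} (G : Graph n) : List (Fin n) → Set where
  single : ∀ {v} → Chain G (v ∷ [])
  cons   : ∀ {u v vs} → Edge G u v → Chain G (v ∷ vs) → Chain G (u ∷ v ∷ vs)

HasCycle : ∀ {n} → Graph n → Set
HasCycle {n} G =
  Σ (Fin n) λ v → Σ (List (Fin n)) λ vs → Σ (Fin n) λ w →
    Chain G ((v ∷ vs) ∷ʳ w) × Unique ((v ∷ vs) ∷ʳ w) × 1 ≤ length vs × Edge G w v

IsTree : ∀ {n} → Graph n → Set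
IsTree {n} G = 1 ≤ n × Connected G × ¬ HasCycle G

weight : ∀ {n} → (Fin n → ℕ) → ℕ
weight {n} f = sum (map f (allFin n))

IsPRDF : ∀ {n} → Graph n → (Fin n → ℕ) → Set
IsPRDF {n} G f =
  (∀ v → f v ≤ 2) ×
  (∀ u → f u ≡ 0 →
     Σ (Fin n) λ v → Edge G u v × f v ≡ 2 ×
       (∀ w → Edge G u w → f w ≡ 2 → w ≡ v))

IsγRp : ∀ {n} → Graph n → ℕ → Set
IsγRp G k =
  (Σ _ λ f → IsPRDF G f × weight f ≡ k) ×
  (∀ f → IsPRDF G f → k ≤ weight f)

IsγRpFunction : ∀ {n} → Graph n → (Fin n → ℕ) → Set
IsγRpFunction G f = IsPRDF G f × (∀ g → IsPRDF G g → weight f ≤ weight g)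

deleteVertex : ∀ {n} → Graph (suc n) → Fin (suc n) → Graph n
deleteVertex G v = record
  { adj = λ i j → adj G (punchIn v i) (punchIn v j)
  ; sym = λ i j → sym G (punchIn v i) (punchIn v j)
  ; irrefl = λ i → irrefl G (punchIn v i) }

PRDStable : ∀ {n} → Graph (suc n) → Set
PRDStable G = ∀ v k → IsγRp G k → IsγRp (deleteVertex G v) k

InW : ∀ {n} → Graph n → Fin n → Set
InW G u = ∀ f → IsγRpFunction G f → f u ≡ 0

-- T' : new vertices v₁ = zero, v₂ = suc zero, old vertex i ↦ suc (suc i);
-- edges: those of T, v₂v₁, and u v₂.
attachAdj : ∀ {n} → Graph n → Fin n → Fin (suc (suc n)) → Fin (suc (suc n)) → Bool
attachAdj G u zero          zero          = false
attachAdj G u zero          (suc zero)    = true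
attachAdj G u zero          (suc (suc j)) = false
attachAdj G u (suc zero)    zero          = true
attachAdj G u (suc zero)    (suc zero)    = false
attachAdj G u (suc zero)    (suc (suc j)) = isYes (u ≟ j)
attachAdj G u (suc (suc i)) zero          = false
attachAdj G u (suc (suc i)) (suc zero)    = isYes (u ≟ i)
attachAdj G u (suc (suc i)) (suc (suc j)) = adj G i j

attachSym : ∀ {n} (G : Graph n) (u : Fin n) → ∀ i j → attachAdj G u i j ≡ attachAdj G u j i
attachSym G u zero          zero          = refl
attachSym G u zero          (suc zero)    = refl
attachSym G u zero          (suc (suc j)) = refl
attachSym G u (suc zero)    zero          = refl
attachSym G u (suc zero)    (suc zero)    = refl
attachSym G u (suc zero)    (suc (suc j)) = refl
attachSym G u (suc (suc i)) zero          = refl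
attachSym G u (suc (suc i)) (suc zero)    = refl
attachSym G u (suc (suc i)) (suc (suc j)) = sym G i j

attachIrrefl : ∀ {n} (G : Graph n) (u : Fin n) → ∀ i → attachAdj G u i i ≡ false
attachIrrefl G u zero          = refl
attachIrrefl G u (suc zero)    = refl
attachIrrefl G u (suc (suc i)) = irrefl G i

attachPendantP2 : ∀ {n} → Graph n → Fin n → Graph (suc (suc n))
attachPendantP2 G u = record
  { adj = attachAdj G u ; sym = attachSym G u ; irrefl = attachIrrefl G u }

module Submission where

-- Write T′ for T with the pendant path v₂v₁ attached at u, and
-- k = γ_R^p(T).  Since u ∈ W(T), a minimum PRDF f of T has f(u) = 0, so f
-- extended by v₁ ↦ 2, v₂ ↦ 0 is a PRDF of T′ of weight k + 2.
-- Conversely let g be a PRDF of T′.  The pendant pair forces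
-- g(v₁) + g(v₂) ≥ 2 unless g(v₁) = 1, g(v₂) = 0 and g(u) = 2.  The weight of
-- g on the old vertices is at least k: if g(u) = 0, then g restricted to
-- T - u is a PRDF of T - u, whose value is k by stability; otherwise g
-- restricted to T is a PRDF of T.  In the exceptional case g(u) = 2 the
-- restriction to T cannot be minimum, since minimum PRDFs of T vanish on
-- u ∈ W(T); so the old part then weighs at least k + 1.  Either way
-- w(g) ≥ k + 2.

open import Defs
open import Data.Nat using (ℕ; suc; _+_)
open import Data.Fin using (Fin)

open import Data.Bool using (true)
open import Data.Bool.Properties using (T-≡)
open import Data.Nat using (zero; _≤_; _<_; z≤n; s≤s)
open import Data.Nat.Properties using (+-comm; +-assoc; +-mono-≤; ≤-refl; ≤-trans; m≤m+n; m≤n+m; ≤∧≢⇒<)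
  renaming (_≟_ to _≟ℕ_)
open import Data.Fin using (zero; suc; punchIn; punchOut; _≟_)
open import Data.Fin.Properties using (punchIn-punchOut; punchInᵢ≢i; punchIn-injective; suc-injective)
open import Data.List.Properties using (map-tabulate)
open import Data.Nat.ListAction using (sum)
open import Data.Product using (Σ; _×_; _,_; proj₂)
open import Data.Sum using (_⊎_; inj₁; inj₂)
open import Data.Empty using (⊥-elim)
open import Function using (_∘_; id)
open import Function.Bundles using (Equivalence)
open import Relation.Nullary using (Dec; yes; no)
open import Relation.Nullary.Decidable using (isYes; toWitness)
open import Relation.Binary.PropositionalEquality
  using (_≡_; _≢_; refl; trans; cong; subst; subst₂; module ≡-Reasoning)
  renaming (sym to ≡-sym)

2≢0 : 2 ≢ 0
2≢0 ()

isYes-true : ∀ {p} {P : Set p} (d : Dec P) → isYes d ≡ true → P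
isYes-true d e = toWitness {a? = d} (Equivalence.from T-≡ e)

split-bound : ∀ a b {c x y} → x ≤ a + b → y ≤ c → x + y ≤ a + (b + c)
split-bound a b {c} {x} {y} p q = subst (x + y ≤_) (+-assoc a b c) (+-mono-≤ p q)

weight-suc : ∀ {m} (f : Fin (suc m) → ℕ) → weight f ≡ f zero + weight (λ i → f (suc i))
weight-suc f = trans (cong sum (map-tabulate id f))
                     (cong (f zero +_) (≡-sym (cong sum (map-tabulate id (λ i → f (suc i))))))

weight-punchIn : ∀ {m} (f : Fin (suc m) → ℕ) (u : Fin (suc m)) →
                 weight f ≡ f u + weight (f ∘ punchIn u)
weight-punchIn f zero = weight-suc f
weight-punchIn {suc m} f (suc u) = begin
  weight f                               ≡⟨ weight-suc f ⟩
  f zero + weight (λ i → f (suc i))      ≡⟨ cong (f zero +_) (weight-punchIn (λ i → f (suc i)) u) ⟩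
  f zero + (f (suc u) + rest)            ≡⟨ ≡-sym (+-assoc (f zero) _ rest) ⟩
  (f zero + f (suc u)) + rest            ≡⟨ cong (_+ rest) (+-comm (f zero) _) ⟩
  (f (suc u) + f zero) + rest            ≡⟨ +-assoc (f (suc u)) _ rest ⟩
  f (suc u) + (f zero + rest)            ≡⟨ cong (f (suc u) +_) (≡-sym (weight-suc (f ∘ punchIn (suc u)))) ⟩
  f (suc u) + weight (f ∘ punchIn (suc u)) ∎
  where
  open ≡-Reasoning
  rest : ℕ
  rest = weight (λ i → f (suc (punchIn u i)))

UniquelyDominated : ∀ {n} → Graph n → (Fin n → ℕ) → Fin n → Set
UniquelyDominated {n} G f x =
  Σ (Fin n) λ v → Edge G x v × f v ≡ 2 × (∀ w → Edge G x w → f w ≡ 2 → w ≡ v)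

minimum-is-γRpFunction : ∀ {n} (G : Graph n) {k f} →
  IsγRp G k → IsPRDF G f → weight f ≡ k → IsγRpFunction G f
minimum-is-γRpFunction G (_ , low) pf wf = pf , λ g pg → subst (_≤ weight g) (≡-sym wf) (low g pg)

positive-on-W-not-minimum : ∀ {n} (G : Graph n) {k u f} →
  IsγRp G k → InW G u → IsPRDF G f → f u ≢ 0 → k < weight f
positive-on-W-not-minimum G γ@(_ , low) inW pf fu≢0 =
  ≤∧≢⇒< (low _ pf) λ k≡w → fu≢0 (inW _ (minimum-is-γRpFunction G γ pf (≡-sym k≡w)))

pattern v₁ = zero
pattern v₂ = suc zero
pattern old i = suc (suc i)

weight-attach : ∀ {m} (g : Fin (suc (suc m)) → ℕ) →
  weight g ≡ g v₁ + (g v₂ + weight (λ i → g (old i)))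
weight-attach g = trans (weight-suc g) (cong (g v₁ +_) (weight-suc (λ i → g (suc i))))

module Attached {n} (T : Graph (suc n)) (u : Fin (suc n)) where

  T′ : Graph (suc (suc (suc n)))
  T′ = attachPendantP2 T u

  v₂-neighbour : ∀ {i} → Edge T′ v₂ (old i) → u ≡ i
  v₂-neighbour = isYes-true (u ≟ _)

  oldPart : (Fin (suc (suc (suc n))) → ℕ) → Fin (suc n) → ℕ
  oldPart g i = g (old i)

  extend : (Fin (suc n) → ℕ) → Fin (suc (suc (suc n))) → ℕ
  extend f v₁      = 2
  extend f v₂      = 0
  extend f (old i) = f i

  extend-weight : ∀ f → weight (extend f) ≡ weight f + 2
  extend-weight f = trans (weight-attach (extend f)) (+-comm 2 (weight f))

  extend-PRDF : ∀ f → IsPRDF T f → f u ≡ 0 → IsPRDF T′ (extend f)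
  extend-PRDF f (bound , perfect) fu≡0 = bound′ , perfect′
    where
    bound′ : ∀ v → extend f v ≤ 2
    bound′ v₁      = ≤-refl
    bound′ v₂      = z≤n
    bound′ (old i) = bound i

    -- v₁ is the unique neighbour of v₂ with value 2, because f(u) = 0.
    v₂-unique : ∀ w → Edge T′ v₂ w → extend f w ≡ 2 → w ≡ v₁
    v₂-unique v₁      _ _  = refl
    v₂-unique (old j) e fj =
      ⊥-elim (2≢0 (trans (≡-sym fj) (subst (λ x → f x ≡ 0) (v₂-neighbour e) fu≡0)))

    perfect′ : ∀ x → extend f x ≡ 0 → UniquelyDominated T′ (extend f) x
    perfect′ v₂ _ = v₁ , refl , refl , v₂-unique
    perfect′ (old i) fi≡0 with perfect i fi≡0
    ... | v , e , fv , unique = old v , e , fv , unique′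
      where
      unique′ : ∀ w → Edge T′ (old i) w → extend f w ≡ 2 → w ≡ old v
      unique′ (old j) e′ fj = cong (λ x → old x) (unique j e′ fj)

  -- If g(u) ≠ 0, the old part of a PRDF g of T′ is a PRDF of T: the unique
  -- value-2 neighbour of a vertex of T cannot be v₂.
  restrict : ∀ g → IsPRDF T′ g → g (old u) ≢ 0 → IsPRDF T (oldPart g)
  restrict g (bound , perfect) gu≢0 = (λ i → bound (old i)) , perfect′
    where
    perfect′ : ∀ i → g (old i) ≡ 0 → UniquelyDominated T (oldPart g) i
    perfect′ i gi≡0 with perfect (old i) gi≡0
    ... | v₂ , e , _ = ⊥-elim (gu≢0 (subst (λ x → g (old x) ≡ 0) (≡-sym (v₂-neighbour e)) gi≡0))
    ... | old j , e , gj , unique =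
          j , e , gj , λ w e′ gw → suc-injective (suc-injective (unique (old w) e′ gw))

  -- If g(u) = 0, the old part of a PRDF g of T′ with u deleted is a PRDF of
  -- T - u: the value-2 neighbour of a vertex of T - u is neither v₂ nor u.
  restrict-delete : ∀ g → IsPRDF T′ g → g (old u) ≡ 0 →
                    IsPRDF (deleteVertex T u) (oldPart g ∘ punchIn u)
  restrict-delete g (bound , perfect) gu≡0 = (λ i → bound (old (punchIn u i))) , perfect′
    where
    perfect′ : ∀ i → g (old (punchIn u i)) ≡ 0 →
               UniquelyDominated (deleteVertex T u) (oldPart g ∘ punchIn u) i
    perfect′ i gi≡0 with perfect (old (punchIn u i)) gi≡0
    ... | v₂ , e , _ = ⊥-elim (punchInᵢ≢i u i (≡-sym (v₂-neighbour e)))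
    ... | old w , e , gw , unique = punchOut u≢w , e′ , gw′ , unique′
      where
      u≢w : u ≢ w
      u≢w u≡w = 2≢0 (trans (≡-sym gw) (subst (λ x → g (old x) ≡ 0) u≡w gu≡0))
      w≡ : punchIn u (punchOut u≢w) ≡ w
      w≡ = punchIn-punchOut u≢w
      e′ : Edge T (punchIn u i) (punchIn u (punchOut u≢w))
      e′ = subst (Edge T (punchIn u i)) (≡-sym w≡) e
      gw′ : g (old (punchIn u (punchOut u≢w))) ≡ 2
      gw′ = subst (λ x → g (old x) ≡ 2) (≡-sym w≡) gw
      unique′ : ∀ w′ → Edge T (punchIn u i) (punchIn u w′) → g (old (punchIn u w′)) ≡ 2 →
                w′ ≡ punchOut u≢w
      unique′ w′ ew′ gw′₂ = punchIn-injective u w′ _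
        (trans (suc-injective (suc-injective (unique (old (punchIn u w′)) ew′ gw′₂))) (≡-sym w≡))

  pendant-pair : ∀ g → IsPRDF T′ g →
                 (2 ≤ g v₁ + g v₂) ⊎ (1 ≤ g v₁ × g (old u) ≡ 2)
  pendant-pair g (_ , perfect) with g v₁ in e₁ | g v₂ in e₂
  ... | 0 | _ with perfect v₁ e₁
  ...   | v₂ , _ , g₂ , _ = inj₁ (subst (2 ≤_) (trans (≡-sym g₂) e₂) ≤-refl)
  pendant-pair g _ | suc (suc _) | _ = inj₁ (s≤s (s≤s z≤n))
  pendant-pair g _ | 1 | suc _ = inj₁ (s≤s (s≤s z≤n))
  pendant-pair g (_ , perfect) | 1 | 0 with perfect v₂ e₂
  ...   | v₁ , _ , g₁ , _ with () ← trans (≡-sym e₁) g₁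
  ...   | old j , e , gj , _ =
          inj₂ (s≤s z≤n , subst (λ x → g (old x) ≡ 2) (≡-sym (v₂-neighbour e)) gj)

  -- On a stable T, every PRDF of T′ weighs at least γ_R^p(T) on the old
  -- vertices: compare with T - u when g(u) = 0, with T otherwise.
  oldPart-bound : PRDStable T → ∀ {k} → IsγRp T k →
                  ∀ g → IsPRDF T′ g → k ≤ weight (oldPart g)
  oldPart-bound stable {k} γ g pg with g (old u) ≟ℕ 0
  ... | yes gu≡0 =
        subst (k ≤_) (≡-sym (weight-punchIn (oldPart g) u))
          (≤-trans (proj₂ (stable u k γ) _ (restrict-delete g pg gu≡0)) (m≤n+m _ _))
  ... | no gu≢0 = proj₂ γ _ (restrict g pg gu≢0)

open Attached

lemma3 : ∀ {n} (T : Graph (suc n)) (u : Fin (suc n)) →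
    IsTree T → PRDStable T → InW T u →
    ∀ k → IsγRp T k → IsγRp (attachPendantP2 T u) (k + 2)
lemma3 T u _ stable inW k γ@((f , pf , wf) , _) = (extend T u f , upper , weight-eq) , lower
  where
  -- Upper bound: extend a minimum PRDF of T, which vanishes on u ∈ W(T).
  upper : IsPRDF (attachPendantP2 T u) (extend T u f)
  upper = extend-PRDF T u f pf (inW f (minimum-is-γRpFunction T γ pf wf))
  weight-eq : weight (extend T u f) ≡ k + 2
  weight-eq = trans (extend-weight T u f) (cong (_+ 2) wf)

  -- Lower bound: 2 + k is split between the pendant pair and the old part.
  lower : ∀ g → IsPRDF (attachPendantP2 T u) g → k + 2 ≤ weight g
  lower g pg = subst₂ _≤_ (+-comm 2 k) (≡-sym (weight-attach g)) (split (pendant-pair T u g pg))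
    where
    split : (2 ≤ g v₁ + g v₂) ⊎ (1 ≤ g v₁ × g (old u) ≡ 2) →
            2 + k ≤ g v₁ + (g v₂ + weight (oldPart T u g))
    split (inj₁ pair≥2) = split-bound (g v₁) (g v₂) pair≥2 (oldPart-bound T u stable γ g pg)
    split (inj₂ (g₁≥1 , gu≡2)) =
      split-bound (g v₁) (g v₂) (≤-trans g₁≥1 (m≤m+n _ _))
        (positive-on-W-not-minimum T γ inW (restrict T u g pg gu≢0) gu≢0)
      where
      gu≢0 : g (old u) ≢ 0
      gu≢0 = λ gu≡0 → 2≢0 (trans (≡-sym gu≡2) gu≡0)
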